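{- (a) A ring $R$ is reduced if and only if the polynomial $1$ in $R[x]$ is not a product of two polynomials of positive degree. (b) A ring $R$ is reduced and indecomposable if and only if neither of the polynomials $1$ and $x$ in $R[x]$ is a product of two polynomials of positive degree.
   Context: All rings are nonzero, commutative and unital. Reduced: no nonzero nilpotent elements; indecomposable: the only idempotents are $0$ and $1$. -}

module Defs where

open import Level using (_⊔_)
open import Algebra.Bundles using (CommutativeRing)
open import Data.Nat using (ℕ; zero; suc; _≤_)
open import Data.List using (List; []; _∷_; map)
open import Data.Product using (Σ; ∃; _×_)
open import Relation.Nullary using (¬_)

module _ {c ℓ} (R : CommutativeRing c ℓ) where
  open CommutativeRing R

  pow : Carrier → ℕ → Carrier
  pow x zero    = 1#
  pow x (suc n) = x * pow x n

  Nilpotent : Carrier → Set ℓ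
  Nilpotent x = ∃ λ n → pow x n ≈ 0#

  IsReduced : Set (c ⊔ ℓ)
  IsReduced = ¬ (Σ Carrier λ x → Nilpotent x × ¬ (x ≈ 0#))

  IsIndecomposable : Set (c ⊔ ℓ)
  IsIndecomposable =
    ¬ (Σ Carrier λ e → (e * e ≈ e) × ¬ (e ≈ 0#) × ¬ (e ≈ 1#))

  -- Polynomials R[x] as coefficient lists  a₀ ∷ a₁ ∷ … (lowest first);
  -- trailing zero coefficients allowed, equality is coefficientwise.

  Poly : Set c
  Poly = List Carrier

  coeff : Poly → ℕ → Carrier
  coeff []       _       = 0#
  coeff (a ∷ f)  zero    = a
  coeff (a ∷ f)  (suc n) = coeff f n

  _≈ₚ_ : Poly → Poly → Set ℓ
  f ≈ₚ g = ∀ n → coeff f n ≈ coeff g n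

  _+ₚ_ : Poly → Poly → Poly
  []      +ₚ g       = g
  (a ∷ f) +ₚ []      = a ∷ f
  (a ∷ f) +ₚ (b ∷ g) = (a + b) ∷ (f +ₚ g)

  _*ₚ_ : Poly → Poly → Poly
  []      *ₚ g = []
  (a ∷ f) *ₚ g = map (a *_) g +ₚ (0# ∷ (f *ₚ g))

  1ₚ : Poly
  1ₚ = 1# ∷ []

  Xₚ : Poly
  Xₚ = 0# ∷ 1# ∷ []

  PositiveDegree : Poly → Set ℓ
  PositiveDegree f = ∃ λ i → (1 ≤ i) × ¬ (coeff f i ≈ 0#)

  ProductOfPositiveDegree : Poly → Set (c ⊔ ℓ)
  ProductOfPositiveDegree h =
    Σ Poly λ f → Σ Poly λ g →
      PositiveDegree f × PositiveDegree g × ((f *ₚ g) ≈ₚ h)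

-- Main lemma: over a reduced ring, if a·b = k with deg a ≤ n and deg b ≤ m,
-- then k·aᵢ = 0 for all i ≥ 1; by lexicographic induction on (n, m), using
-- that the top coefficients satisfy aₙbₘ = 0, so replacing b by aₙb lowers m
-- and, once k·aₙ = 0 is known, replacing a by ka lowers n.  Reducedness only
-- yields "x is not nonzero", so these equalities live in the double-negation
-- monad, which suffices since all goals are negations.
-- (a) k = 1 gives ⇒; conversely b² = 0 gives (1 + bx)(1 − bx) = 1, and
--     nilpotents are killed by repeated squaring.
-- (b) a·b = x yields the idempotent a₀b₁ with complement a₁b₀, and dividing
--     a factor by x shows it is neither 0 nor 1; conversely an idempotent
--     e ≠ 0, 1 gives x = ((1 − e) + ex)(e + (1 − e)x).
module Submission where

open import Defs
open import Algebra.Bundles using (CommutativeRing)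
open import Data.Product using (_×_; _,_; ∃)
open import Data.Sum using (inj₁; inj₂)
open import Function.Bundles using (_⇔_; mk⇔)
open import Relation.Nullary using (¬_)
open import Relation.Nullary.Negation using (¬¬-Monad)
open import Effect.Monad using (RawMonad)
open import Data.Nat using (ℕ; zero; suc; _≤_; z≤n; s≤s)
import Data.Nat as ℕ
import Data.Nat.Properties as ℕ
open import Data.List using ([]; _∷_; map; length)
import Relation.Binary.PropositionalEquality as P

module PolynomialFactorisation {c ℓ} (R : CommutativeRing c ℓ) where
  open CommutativeRing R
  open import Relation.Binary.Reasoning.Setoid setoid
  open import Algebra.Solver.Ring.NaturalCoefficients.Default commutativeSemiring
  open RawMonad (¬¬-Monad {ℓ}) using (return; _>>=_)

  Seq : Set c
  Seq = ℕ → Carrier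

  conv : Seq → Seq → Seq
  conv a b zero    = a 0 * b 0
  conv a b (suc i) = a 0 * b (suc i) + conv (λ j → a (suc j)) b i

  _·ₛ_ : Carrier → Seq → Seq
  (s ·ₛ a) i = s * a i

  VanishesFrom : Seq → ℕ → Set ℓ
  VanishesFrom a n = ∀ i → n ≤ i → a i ≈ 0#

  ProductIs : Seq → Seq → Poly R → Set ℓ
  ProductIs a b h = ∀ i → conv a b i ≈ coeff R h i

  ConstProduct : Seq → Seq → Carrier → Set ℓ
  ConstProduct a b k = ProductIs a b (k ∷ [])

  HigherCoeffNonzero : Seq → Set ℓ
  HigherCoeffNonzero a = ∃ λ i → (1 ≤ i) × ¬ (a i ≈ 0#)

  vanishes-weaken : ∀ {a n} → VanishesFrom a n → VanishesFrom a (suc n)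
  vanishes-weaken ha i p = ha i (ℕ.<⇒≤ p)

  vanishes-shift : ∀ {a n} → VanishesFrom a (suc n) → VanishesFrom (λ j → a (suc j)) n
  vanishes-shift ha i p = ha (suc i) (s≤s p)

  vanishes-scale : ∀ {a n} s → VanishesFrom a n → VanishesFrom (s ·ₛ a) n
  vanishes-scale s ha i p = trans (*-congˡ (ha i p)) (zeroʳ s)

  vanishes-lower : ∀ {a n} → VanishesFrom a (suc (suc n)) → a (suc n) ≈ 0# →
                   VanishesFrom a (suc n)
  vanishes-lower ha top i p with ℕ.m≤n⇒m<n∨m≡n p
  ... | inj₁ q      = ha i q
  ... | inj₂ P.refl = top

  conv-zeroˡ : ∀ a b → (∀ j → a j ≈ 0#) → ∀ i → conv a b i ≈ 0#
  conv-zeroˡ a b z zero    = trans (*-congʳ (z 0)) (zeroˡ _)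
  conv-zeroˡ a b z (suc i) =
    trans (+-cong (trans (*-congʳ (z 0)) (zeroˡ _)) (conv-zeroˡ _ b (λ j → z (suc j)) i))
          (+-identityˡ _)

  conv-scaleˡ : ∀ s a b i → conv (s ·ₛ a) b i ≈ s * conv a b i
  conv-scaleˡ s a b zero    = *-assoc _ _ _
  conv-scaleˡ s a b (suc i) =
    trans (+-cong (*-assoc _ _ _) (conv-scaleˡ s _ b i)) (sym (distribˡ _ _ _))

  conv-sucʳ : ∀ a b i → conv a b (suc i) ≈ a (suc i) * b 0 + conv a (λ j → b (suc j)) i
  conv-sucʳ a b zero    = +-comm _ _
  conv-sucʳ a b (suc i) = begin
    a 0 * b (suc (suc i)) + conv a′ b (suc i)
      ≈⟨ +-congˡ (conv-sucʳ a′ b i) ⟩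
    a 0 * b (suc (suc i)) + (a (suc (suc i)) * b 0 + conv a′ b′ i)
      ≈⟨ solve 3 (λ x y z → x :+ (y :+ z) := y :+ (x :+ z)) refl _ _ _ ⟩
    a (suc (suc i)) * b 0 + (a 0 * b (suc (suc i)) + conv a′ b′ i) ∎
    where
    a′ b′ : Seq
    a′ j = a (suc j)
    b′ j = b (suc j)

  conv-comm : ∀ a b i → conv a b i ≈ conv b a i
  conv-comm a b zero    = *-comm _ _
  conv-comm a b (suc i) =
    trans (+-cong (*-comm _ _) (conv-comm _ b i)) (sym (conv-sucʳ b a i))

  conv-scaleʳ : ∀ s a b i → conv a (s ·ₛ b) i ≈ s * conv a b i
  conv-scaleʳ s a b i =
    trans (conv-comm a _ i) (trans (conv-scaleˡ s b a i) (*-congˡ (conv-comm b a i)))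

  product-comm : ∀ a b h → ProductIs a b h → ProductIs b a h
  product-comm a b h p i = trans (conv-comm b a i) (p i)

  conv-constˡ : ∀ a b → VanishesFrom a 1 → ∀ i → conv a b i ≈ a 0 * b i
  conv-constˡ a b ha zero    = refl
  conv-constˡ a b ha (suc i) =
    trans (+-congˡ (conv-zeroˡ _ b (λ j → ha (suc j) (s≤s z≤n)) i)) (+-identityʳ _)

  conv-constʳ : ∀ a b → VanishesFrom b 1 → ∀ i → conv a b i ≈ a i * b 0
  conv-constʳ a b hb i = trans (conv-comm a b i) (trans (conv-constˡ b a hb i) (*-comm _ _))

  conv-top : ∀ n m a b → VanishesFrom a (suc n) → VanishesFrom b (suc m) →
             conv a b (n ℕ.+ m) ≈ a n * b m
  conv-top zero    m a b ha hb = conv-constˡ a b ha m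
  conv-top (suc n) m a b ha hb =
    trans (+-cong (trans (*-congˡ (hb (suc (n ℕ.+ m)) (s≤s (ℕ.m≤n+m m n)))) (zeroʳ _))
                  (conv-top n m _ b (vanishes-shift ha) hb))
          (+-identityˡ _)

  conv-shiftˡ : ∀ a b → a 0 ≈ 0# → ∀ i → conv a b (suc i) ≈ conv (λ j → a (suc j)) b i
  conv-shiftˡ a b a₀≈0 i = trans (+-congʳ (trans (*-congʳ a₀≈0) (zeroˡ _))) (+-identityˡ _)

  scale-const : ∀ s k i → s * coeff R (k ∷ []) i ≈ coeff R (s * k ∷ []) i
  scale-const s k zero    = refl
  scale-const s k (suc i) = zeroʳ s

  const-scaleˡ : ∀ {a b k} s → ConstProduct a b k → ConstProduct (s ·ₛ a) b (s * k)
  const-scaleˡ {a} {b} {k} s p i =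
    trans (conv-scaleˡ s a b i) (trans (*-congˡ (p i)) (scale-const s k i))

  const-scaleʳ : ∀ {a b k} s → ConstProduct a b k → ConstProduct a (s ·ₛ b) (s * k)
  const-scaleʳ {a} {b} {k} s p i =
    trans (conv-scaleʳ s a b i) (trans (*-congˡ (p i)) (scale-const s k i))

  coeff-+ : ∀ f g i → coeff R (_+ₚ_ R f g) i ≈ coeff R f i + coeff R g i
  coeff-+ []      g       i       = sym (+-identityˡ _)
  coeff-+ (a ∷ f) []      i       = sym (+-identityʳ _)
  coeff-+ (a ∷ f) (b ∷ g) zero    = refl
  coeff-+ (a ∷ f) (b ∷ g) (suc i) = coeff-+ f g i

  coeff-map : ∀ a g i → coeff R (map (a *_) g) i ≈ a * coeff R g i
  coeff-map a []      i       = sym (zeroʳ a)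
  coeff-map a (b ∷ g) zero    = refl
  coeff-map a (b ∷ g) (suc i) = coeff-map a g i

  coeff-conv : ∀ f g i → coeff R (_*ₚ_ R f g) i ≈ conv (coeff R f) (coeff R g) i
  coeff-conv []      g i       = sym (conv-zeroˡ _ _ (λ _ → refl) i)
  coeff-conv (a ∷ f) g zero    =
    trans (coeff-+ (map (a *_) g) _ 0) (trans (+-identityʳ _) (coeff-map a g 0))
  coeff-conv (a ∷ f) g (suc i) =
    trans (coeff-+ (map (a *_) g) _ (suc i)) (+-cong (coeff-map a g (suc i)) (coeff-conv f g i))

  coeff-vanishes : ∀ f → VanishesFrom (coeff R f) (length f)
  coeff-vanishes []      i       p       = refl
  coeff-vanishes (a ∷ f) (suc i) (s≤s p) = coeff-vanishes f i p

  product-coeffs : ∀ f g h → _≈ₚ_ R (_*ₚ_ R f g) h → ProductIs (coeff R f) (coeff R g) h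
  product-coeffs f g h e i = trans (sym (coeff-conv f g i)) (e i)

  nilpotent-vanishes : IsReduced R → ∀ x n → pow R x n ≈ 0# → ¬ ¬ (x ≈ 0#)
  nilpotent-vanishes red x n p x≉0 = red (x , (n , p) , x≉0)

  square-annihilates : IsReduced R → ∀ k x → (x * k) * x ≈ 0# → ¬ ¬ (k * x ≈ 0#)
  square-annihilates red k x h = nilpotent-vanishes red (k * x) 2 (begin
    (k * x) * ((k * x) * 1#) ≈⟨ solve 2 (λ k x → (k :* x) :* ((k :* x) :* con 1)
                                             := k :* ((x :* k) :* x)) refl k x ⟩
    k * ((x * k) * x)        ≈⟨ *-congˡ h ⟩
    k * 0#                   ≈⟨ zeroʳ k ⟩
    0#                       ∎)

  cube-annihilates : IsReduced R → ∀ k x → (k * k) * (k * x) ≈ 0# → ¬ ¬ (k * x ≈ 0#)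
  cube-annihilates red k x h = nilpotent-vanishes red (k * x) 3 (begin
    (k * x) * ((k * x) * ((k * x) * 1#))
      ≈⟨ solve 2 (λ k x → (k :* x) :* ((k :* x) :* ((k :* x) :* con 1))
                          := (x :* x) :* ((k :* k) :* (k :* x))) refl k x ⟩
    (x * x) * ((k * k) * (k * x)) ≈⟨ *-congˡ h ⟩
    (x * x) * 0#                  ≈⟨ zeroʳ _ ⟩
    0#                            ∎)

  const-product-annihilates :
    IsReduced R → ∀ n m a b k → VanishesFrom a (suc n) → VanishesFrom b (suc m) →
    ConstProduct a b k → ∀ i → ¬ ¬ (k * a (suc i) ≈ 0#)
  const-product-annihilates red zero m a b k ha hb p i =
    return (trans (*-congˡ (ha (suc i) (s≤s z≤n))) (zeroʳ k))
  const-product-annihilates red (suc n) zero a b k ha hb p i = return (begin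
    k * a (suc i)           ≈⟨ *-congʳ (sym (p 0)) ⟩
    (a 0 * b 0) * a (suc i) ≈⟨ solve 3 (λ x y z → (x :* y) :* z := x :* (z :* y)) refl _ _ _ ⟩
    a 0 * (a (suc i) * b 0) ≈⟨ *-congˡ (trans (sym (conv-constʳ a b hb (suc i))) (p (suc i))) ⟩
    a 0 * 0#                ≈⟨ zeroʳ _ ⟩
    0#                      ∎)
  const-product-annihilates red (suc n) (suc m) a b k ha hb p i = do
    aₙk·aₙ≈0 ← const-product-annihilates red (suc n) m a (aₙ ·ₛ b) (aₙ * k)
                 ha (vanishes-lower (vanishes-scale aₙ hb) top≈0) (const-scaleʳ aₙ p) n
    kaₙ≈0    ← square-annihilates red k aₙ aₙk·aₙ≈0
    k²·kaᵢ≈0 ← const-product-annihilates red n (suc m) (k ·ₛ a) b (k * k)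
                 (vanishes-lower (vanishes-scale k ha) kaₙ≈0) hb (const-scaleˡ k p) i
    cube-annihilates red k (a (suc i)) k²·kaᵢ≈0
    where
    aₙ : Carrier
    aₙ = a (suc n)
    top≈0 : aₙ * b (suc m) ≈ 0#
    top≈0 = trans (sym (conv-top (suc n) (suc m) a b ha hb)) (p (suc n ℕ.+ suc m))

  unit-factor-constant : IsReduced R → ∀ {a b} n m → VanishesFrom a n → VanishesFrom b m →
                         ProductIs a b (1ₚ R) → ¬ HigherCoeffNonzero a
  unit-factor-constant red n m ha hb p (suc i , _ , aᵢ≉0) =
    const-product-annihilates red n m _ _ 1# (vanishes-weaken ha) (vanishes-weaken hb) p i
      (λ 1·aᵢ≈0 → aᵢ≉0 (trans (sym (*-identityˡ _)) 1·aᵢ≈0))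

  reduced⇒1-not-product : IsReduced R → ¬ ProductOfPositiveDegree R (1ₚ R)
  reduced⇒1-not-product red (f , g , pf , _ , e) =
    unit-factor-constant red (length f) (length g) (coeff-vanishes f) (coeff-vanishes g)
                         (product-coeffs f g (1ₚ R) e) pf

  square-zero-vanishes : ¬ ProductOfPositiveDegree R (1ₚ R) → ∀ b → b * b ≈ 0# → ¬ ¬ (b ≈ 0#)
  square-zero-vanishes noFactor b b²≈0 b≉0 =
    noFactor ((1# ∷ b ∷ []) , (1# ∷ - b ∷ []) , (1 , s≤s z≤n , b≉0) ,
              (1 , s≤s z≤n , λ -b≈0 → b≉0 (-b≈0⇒b≈0 -b≈0)) , product≈1)
    where
    -b≈0⇒b≈0 : - b ≈ 0# → b ≈ 0#
    -b≈0⇒b≈0 q = trans (sym (+-identityʳ b)) (trans (+-congˡ (sym q)) (-‿inverseʳ b))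
    product≈1 : _≈ₚ_ R (_*ₚ_ R (1# ∷ b ∷ []) (1# ∷ - b ∷ [])) (1ₚ R)
    product≈1 0 = trans (+-identityʳ _) (*-identityˡ _)
    product≈1 1 = trans (+-cong (*-identityˡ _) (trans (+-identityʳ _) (*-identityʳ _)))
                        (-‿inverseˡ b)
    product≈1 2 = begin
      b * - b         ≈⟨ sym (+-identityʳ _) ⟩
      b * - b + 0#    ≈⟨ +-congˡ (sym b²≈0) ⟩
      b * - b + b * b ≈⟨ sym (distribˡ _ _ _) ⟩
      b * (- b + b)   ≈⟨ *-congˡ (-‿inverseˡ b) ⟩
      b * 0#          ≈⟨ zeroʳ _ ⟩
      0#              ∎
    product≈1 (suc (suc (suc _))) = refl

  pow-+ : ∀ y m n → pow R y (m ℕ.+ n) ≈ pow R y m * pow R y n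
  pow-+ y zero    n = sym (*-identityˡ _)
  pow-+ y (suc m) n = trans (*-congˡ (pow-+ y m n)) (sym (*-assoc _ _ _))

  -- If square-zero elements vanish, so do nilpotents: from y^(k+2) = 0 we get
  -- (y^(k+1))² = y^(k+2)·y^k = 0, hence y^(k+1) = 0.
  nilpotent-vanishes-by-squaring : (∀ b → b * b ≈ 0# → ¬ ¬ (b ≈ 0#)) →
                                   ∀ k y → pow R y (suc k) ≈ 0# → ¬ ¬ (y ≈ 0#)
  nilpotent-vanishes-by-squaring sq zero    y h = return (trans (sym (*-identityʳ _)) h)
  nilpotent-vanishes-by-squaring sq (suc k) y h = do
    yᵏ⁺¹≈0 ← sq (pow R y (suc k)) (begin
      pow R y (suc k) * pow R y (suc k)       ≈⟨ sym (pow-+ y (suc k) (suc k)) ⟩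
      pow R y (suc k ℕ.+ suc k)               ≈⟨ reflexive (P.cong (λ t → pow R y (suc t)) (ℕ.+-suc k k)) ⟩
      pow R y (suc (suc k) ℕ.+ k)             ≈⟨ pow-+ y (suc (suc k)) k ⟩
      pow R y (suc (suc k)) * pow R y k       ≈⟨ *-congʳ h ⟩
      0# * pow R y k                          ≈⟨ zeroˡ _ ⟩
      0#                                      ∎)
    nilpotent-vanishes-by-squaring sq k y yᵏ⁺¹≈0

  1-not-product⇒reduced : ¬ ProductOfPositiveDegree R (1ₚ R) → IsReduced R
  1-not-product⇒reduced noFactor (x , (zero , 1≈0) , x≉0) =
    x≉0 (trans (sym (*-identityʳ x)) (trans (*-congˡ 1≈0) (zeroʳ x)))
  1-not-product⇒reduced noFactor (x , (suc k , xᵏ⁺¹≈0) , x≉0) =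
    nilpotent-vanishes-by-squaring (square-zero-vanishes noFactor) k x xᵏ⁺¹≈0 x≉0

  cancel-by-unit : ∀ {x y z} → x * y ≈ 0# → z * y ≈ 1# → x ≈ 0#
  cancel-by-unit {x} {y} {z} xy≈0 zy≈1 = begin
    x            ≈⟨ sym (*-identityʳ x) ⟩
    x * 1#       ≈⟨ *-congˡ (sym zy≈1) ⟩
    x * (z * y)  ≈⟨ solve 3 (λ x y z → x :* (z :* y) := z :* (x :* y)) refl x y z ⟩
    z * (x * y)  ≈⟨ *-congˡ xy≈0 ⟩
    z * 0#       ≈⟨ zeroʳ z ⟩
    0#           ∎

  idempotent-of-complement : ∀ {u v} → u + v ≈ 1# → u * v ≈ 0# → u * u ≈ u
  idempotent-of-complement {u} {v} u+v≈1 uv≈0 = begin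
    u * u          ≈⟨ sym (+-identityʳ _) ⟩
    u * u + 0#     ≈⟨ +-congˡ (sym uv≈0) ⟩
    u * u + u * v  ≈⟨ sym (distribˡ _ _ _) ⟩
    u * (u + v)    ≈⟨ *-congˡ u+v≈1 ⟩
    u * 1#         ≈⟨ *-identityʳ u ⟩
    u              ∎

  -- Over a reduced ring, if a·b = x and b has positive degree, then a₀b₁ ≠ 0:
  -- otherwise a₁b₀ = 1 forces a₀ = 0, and (a / x)·b = 1 contradicts the
  -- positive degree of b.
  x-factor-mixed-term : IsReduced R → ∀ {a b} n m → VanishesFrom a n → VanishesFrom b m →
                        ProductIs a b (Xₚ R) → HigherCoeffNonzero b → ¬ (a 0 * b 1 ≈ 0#)
  x-factor-mixed-term red {a} {b} n m ha hb p bPos a₀b₁≈0 =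
    unit-factor-constant red m n hb (vanishes-shift (vanishes-weaken ha))
                         (product-comm _ b (1ₚ R) quotient≈1) bPos
    where
    a₁b₀≈1 : a 1 * b 0 ≈ 1#
    a₁b₀≈1 = trans (sym (+-identityˡ _)) (trans (+-congʳ (sym a₀b₁≈0)) (p 1))
    quotient≈1 : ProductIs (λ j → a (suc j)) b (1ₚ R)
    quotient≈1 i = trans (sym (conv-shiftˡ a b (cancel-by-unit (p 0) a₁b₀≈1) i)) (p (suc i))

  reduced-indecomposable⇒x-not-product :
    IsReduced R → IsIndecomposable R → ¬ ProductOfPositiveDegree R (Xₚ R)
  reduced-indecomposable⇒x-not-product red ind (f , g , fPos , gPos , e) =
    ind (u , idempotent-of-complement (p 1) uv≈0 , u≉0 , u≉1)
    where
    a b : Seq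
    a = coeff R f
    b = coeff R g
    p : ProductIs a b (Xₚ R)
    p = product-coeffs f g (Xₚ R) e
    u v : Carrier
    u = a 0 * b 1
    v = a 1 * b 0
    uv≈0 : u * v ≈ 0#
    uv≈0 = begin
      u * v                     ≈⟨ solve 4 (λ w x y z → (w :* x) :* (y :* z) := (w :* z) :* (y :* x))
                                           refl (a 0) (b 1) (a 1) (b 0) ⟩
      (a 0 * b 0) * (a 1 * b 1) ≈⟨ *-congʳ (p 0) ⟩
      0# * (a 1 * b 1)          ≈⟨ zeroˡ _ ⟩
      0#                        ∎
    u≉0 : ¬ (u ≈ 0#)
    u≉0 = x-factor-mixed-term red (length f) (length g) (coeff-vanishes f) (coeff-vanishes g) p gPos
    u≉1 : ¬ (u ≈ 1#)
    u≉1 u≈1 = x-factor-mixed-term red (length g) (length f) (coeff-vanishes g) (coeff-vanishes f)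
                (product-comm a b (Xₚ R) p) fPos (trans (*-comm (b 0) (a 1)) v≈0)
      where
      v≈0 : v ≈ 0#
      v≈0 = trans (sym (*-identityˡ v)) (trans (*-congʳ (sym u≈1)) uv≈0)

  x-not-product⇒indecomposable : ¬ ProductOfPositiveDegree R (Xₚ R) → IsIndecomposable R
  x-not-product⇒indecomposable noFactor (e , e²≈e , e≉0 , e≉1) =
    noFactor (f , g , (1 , s≤s z≤n , e≉0) , (1 , s≤s z≤n , λ w≈0 → e≉1 (e≈1 w≈0)) , product≈x)
    where
    w : Carrier
    w = 1# - e
    f g : Poly R
    f = w ∷ e ∷ []
    g = e ∷ w ∷ []
    w+e≈1 : w + e ≈ 1#
    w+e≈1 = trans (+-assoc _ _ _) (trans (+-congˡ (-‿inverseˡ e)) (+-identityʳ _))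
    e≈1 : w ≈ 0# → e ≈ 1#
    e≈1 w≈0 = trans (sym (+-identityˡ _)) (trans (+-congʳ (sym w≈0)) w+e≈1)
    ew≈0 : e * w ≈ 0#
    ew≈0 = begin
      e * (1# + - e)        ≈⟨ distribˡ _ _ _ ⟩
      e * 1# + e * (- e)    ≈⟨ +-congʳ (trans (*-identityʳ _) (sym e²≈e)) ⟩
      e * e + e * (- e)     ≈⟨ sym (distribˡ _ _ _) ⟩
      e * (e + - e)         ≈⟨ *-congˡ (-‿inverseʳ e) ⟩
      e * 0#                ≈⟨ zeroʳ _ ⟩
      0#                    ∎
    we≈0 : w * e ≈ 0#
    we≈0 = trans (*-comm _ _) ew≈0
    product≈x : _≈ₚ_ R (_*ₚ_ R f g) (Xₚ R)
    product≈x 0 = trans (+-identityʳ _) we≈0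
    product≈x 1 = begin
      w * w + (e * e + 0#)              ≈⟨ +-congˡ (+-identityʳ _) ⟩
      w * w + e * e                     ≈⟨ sym (+-identityʳ _) ⟩
      (w * w + e * e) + 0#              ≈⟨ +-congˡ (sym (trans (+-cong we≈0 ew≈0) (+-identityʳ _))) ⟩
      (w * w + e * e) + (w * e + e * w) ≈⟨ solve 2 (λ x y → (x :* x :+ y :* y) :+ (x :* y :+ y :* x)
                                                           := (x :+ y) :* (x :+ y)) refl w e ⟩
      (w + e) * (w + e)                 ≈⟨ *-cong w+e≈1 w+e≈1 ⟩
      1# * 1#                           ≈⟨ *-identityʳ _ ⟩
      1#                                ∎
    product≈x 2 = ew≈0
    product≈x (suc (suc (suc _))) = refl

open PolynomialFactorisation

proposition6p6 : ∀ {c ℓ} (R : CommutativeRing c ℓ) →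
    ¬ (CommutativeRing._≈_ R (CommutativeRing.1# R) (CommutativeRing.0# R)) →
    (IsReduced R ⇔ (¬ ProductOfPositiveDegree R (1ₚ R)))
    × ((IsReduced R × IsIndecomposable R) ⇔
    (¬ ProductOfPositiveDegree R (1ₚ R) × ¬ ProductOfPositiveDegree R (Xₚ R)))
proposition6p6 R _ =
  mk⇔ (reduced⇒1-not-product R) (1-not-product⇒reduced R) ,
  mk⇔ (λ (red , ind) → reduced⇒1-not-product R red , reduced-indecomposable⇒x-not-product R red ind)
      (λ (no1 , noX) → 1-not-product⇒reduced R no1 , x-not-product⇒indecomposable R noX)
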